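{- The normal lax extensions of the functor $H_A=(-)^A\colon\mathbf{Set}\to\mathbf{Set}$ correspond precisely to the upward-closed submonoids of the monoid of endorelations on $A$ consisting only of normal relations.
   Context: Relations $r\subseteq X\times Y$ are composed applicatively, $^\circ$ is converse, functions are regarded as relations, $1_X$ is the identity. A lax extension of $H_A$ is a monotone assignment of $Lr\subseteq X^A\times Y^A$ to each relation $r\subseteq X\times Y$ with $H_Af\le Lf$, $(H_Af)^\circ\le L(f^\circ)$ and $Ls\cdot Lr\le L(s\cdot r)$; it is normal if $L1_X=1_{X^A}$. The correspondence sends $L$ to $\{\phi\subseteq A\times A\mid 1_A\,(L\phi)\,1_A\}$, and a submonoid $\mathcal{A}$ to the extension with $f\,(Lr)\,g$ iff some $\phi\in\mathcal{A}$ satisfies $\phi\le g^\circ\cdot r\cdot f$. An endorelation is normal if its difunctional closure (least relation of the form $g^\circ\cdot f$ containing it) is reflexive. -}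

module Defs where

open import Level using (Level; 0ℓ; _⊔_) renaming (suc to lsuc)
open import Data.Product using (Σ; ∃; _×_; _,_)
open import Relation.Binary.Core using (REL; _⇒_)
open import Relation.Binary.PropositionalEquality using (_≡_; _≗_)
open import Function using (id; _∘_)

private variable
  a b c ℓ₁ ℓ₂ : Level
  X Y Z : Set a

-- Relations r ⊆ X × Y are X → Y → Set ℓ; "≤" is inclusion _⇒_.
-- Equality of relations: mutual inclusion.
_≐_ : {X : Set a} {Y : Set b} → REL X Y ℓ₁ → REL X Y ℓ₂ → Set _
r ≐ s = (r ⇒ s) × (s ⇒ r)

_·_ : {X : Set a} {Y : Set b} {Z : Set c} → REL Y Z ℓ₂ → REL X Y ℓ₁ → REL X Z (b ⊔ ℓ₁ ⊔ ℓ₂)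
(s · r) x z = ∃ λ y → r x y × s y z

infixr 9 _·_

_° : {X : Set a} {Y : Set b} → REL X Y ℓ₁ → REL Y X ℓ₁
(r °) y x = r x y

infix 10 _°

graph : {X : Set a} {Y : Set b} → (X → Y) → REL X Y b
graph f x y = f x ≡ y

Id : (X : Set a) → REL X X a
Id X = _≡_

module _ (A : Set) where

  -- The functor H_A = (-)^A; equality on X^A is extensional (pointwise),
  -- which is the equality of the Set-theoretic function space.
  -- H_A f regarded as a relation X^A → Y^A:
  H : {X Y : Set} → (X → Y) → REL (A → X) (A → Y) 0ℓ
  H f h k = (f ∘ h) ≗ k

  IdE : (X : Set) → REL (A → X) (A → X) 0ℓ
  IdE X = _≗_

  -- Candidate extensions: to each relation r ⊆ X × Y, a relation L r ⊆ X^A × Y^A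
  -- (valued one universe up, for predicativity reasons).
  Ext : Set₂
  Ext = {X Y : Set} → REL X Y 0ℓ → REL (A → X) (A → Y) (lsuc 0ℓ)

  record IsLaxExtension (L : Ext) : Set₁ where
    field
      mono   : {X Y : Set} {r s : REL X Y 0ℓ} → r ⇒ s → L r ⇒ L s
      fun    : {X Y : Set} (f : X → Y) → H f ⇒ L (graph f)
      cofun  : {X Y : Set} (f : X → Y) → (H f) ° ⇒ L ((graph f) °)
      comp   : {X Y Z : Set} (r : REL X Y 0ℓ) (s : REL Y Z 0ℓ) → (L s · L r) ⇒ L (s · r)

  record IsNormalLaxExtension (L : Ext) : Set₁ where
    field
      lax    : IsLaxExtension L
      normal : (X : Set) → L (Id X) ≐ IdE X

  -- Difunctional closure of φ: the least relation of the form g° · f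
  -- containing φ, i.e. the intersection of all such relations.
  -- Note a (g° · f) a' holds iff f a ≡ g a'.
  difClosure : REL A A 0ℓ → REL A A (lsuc 0ℓ)
  difClosure φ a a' = (C : Set) (f g : A → C) → φ ⇒ (graph g) ° · graph f → ((graph g) ° · graph f) a a'

  NormalRel : REL A A 0ℓ → Set₁
  NormalRel φ = (a : A) → difClosure φ a a

  RelSet : Set₂
  RelSet = REL A A 0ℓ → Set₁

  record IsUpNormalSubmonoid (𝒜 : RelSet) : Set₂ where
    field
      unit    : 𝒜 (Id A)
      closed  : {φ ψ : REL A A 0ℓ} → 𝒜 φ → 𝒜 ψ → 𝒜 (ψ · φ)
      upward  : {φ ψ : REL A A 0ℓ} → 𝒜 φ → φ ⇒ ψ → 𝒜 ψ
      normals : {φ : REL A A 0ℓ} → 𝒜 φ → NormalRel φ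

  toSubmonoid : Ext → RelSet
  toSubmonoid L φ = L φ id id

  toExtension : RelSet → Ext
  toExtension 𝒜 r f g = Σ (REL A A 0ℓ) λ φ → 𝒜 φ × (φ ⇒ (graph g) ° · r · graph f)

  _≡ₛ_ : RelSet → RelSet → Set₁
  𝒜 ≡ₛ ℬ = (φ : REL A A 0ℓ) → (𝒜 φ → ℬ φ) × (ℬ φ → 𝒜 φ)

-- Everything reduces to evaluating L at the identity tuple id : A → A. Whiskering with the unit
-- and counit witnesses L(graph f) id f and L((graph f)°) f id shows that f (L r) g holds iff
-- id (L φ) id for some φ ≤ g° · r · f, since g · φ · f° ≤ r for such φ. Applied to r = 1_X,
-- normality L 1_X = 1 turns id (L φ) id with φ ≤ g° · f into f = g, which is normality of φ.
-- Conversely, the extension induced by an upward-closed submonoid is lax because these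
-- pullbacks compose, and normal because its members are normal relations.
module Submission where

open import Defs
open import Data.Product using (_×_; _,_; proj₁; proj₂)
open import Level using (0ℓ)
open import Relation.Binary.Core using (REL; _⇒_)
open import Relation.Binary.PropositionalEquality using (_≡_; _≗_; refl; sym; trans)
open import Function using (id)

pullback : {A X Y : Set} → REL X Y 0ℓ → (A → X) → (A → Y) → REL A A 0ℓ
pullback r f g = (graph g) ° · r · graph f

module _ {A X Y : Set} where

  pullback-mono : {r s : REL X Y 0ℓ} {f : A → X} {g : A → Y} →
                  r ⇒ s → pullback r f g ⇒ pullback s f g
  pullback-mono r⇒s (y , (x , fa≡x , rxy) , ga'≡y) = y , (x , fa≡x , r⇒s rxy) , ga'≡y

  pullback-residual : {r : REL X Y 0ℓ} {f : A → X} {g : A → Y} {φ : REL A A 0ℓ} →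
                      φ ⇒ pullback r f g → graph g · φ · (graph f) ° ⇒ r
  pullback-residual φ⇒ (a' , (a , refl , φaa') , refl) with φ⇒ φaa'
  ... | _ , (_ , refl , r[fa][ga']) , refl = r[fa][ga']

  Id⇒pullback : {r : REL X Y 0ℓ} {f : A → X} {g : A → Y} →
                (∀ a → r (f a) (g a)) → Id A ⇒ pullback r f g
  Id⇒pullback {f = f} {g} r[f][g] {a} refl = g a , (f a , refl , r[f][g] a) , refl

pullback-· : {A X Y Z : Set} {r : REL X Y 0ℓ} {s : REL Y Z 0ℓ}
             {f : A → X} {g : A → Y} {h : A → Z} {φ ψ : REL A A 0ℓ} →
             φ ⇒ pullback r f g → ψ ⇒ pullback s g h → ψ · φ ⇒ pullback (s · r) f h
pullback-· φ⇒ ψ⇒ (a' , φaa' , ψa'a'') with φ⇒ φaa' | ψ⇒ ψa'a''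
... | _ , (x , fa≡x , rxy) , refl | z , (_ , refl , syz) , ha''≡z =
  z , (x , fa≡x , (_ , rxy , syz)) , ha''≡z

pullback-Id : {A X : Set} {f g : A → X} → pullback (Id X) f g ≐ ((graph g) ° · graph f)
pullback-Id = (λ (y , (x , fa≡x , x≡y) , ga'≡y) → y , trans fa≡x x≡y , ga'≡y)
            , (λ (y , fa≡y , ga'≡y) → y , (y , fa≡y , refl) , ga'≡y)

pullback-id : {A : Set} {φ : REL A A 0ℓ} → pullback φ id id ≐ φ
pullback-id = (λ { (_ , (_ , refl , φaa') , refl) → φaa' })
            , (λ {a} {a'} φaa' → a' , (a , refl , φaa') , refl)

module LaxExtension {A : Set} {L : Ext A} (lax : IsLaxExtension A L) where
  open IsLaxExtension lax

  L-graph : {Y : Set} (f : A → Y) → L (graph f) id f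
  L-graph f = fun f (λ _ → refl)

  L-graph° : {Y : Set} (f : A → Y) → L ((graph f) °) f id
  L-graph° f = cofun f (λ _ → refl)

  L-pull : {X Y : Set} {r : REL X Y 0ℓ} {f : A → X} {g : A → Y} →
           L r f g → L (pullback r f g) id id
  L-pull {r = r} {f} {g} Lrfg =
    comp (r · graph f) (graph g °) (g , comp (graph f) r (f , L-graph f , Lrfg) , L-graph° g)

  L-push : {X Y : Set} {r : REL X Y 0ℓ} {f : A → X} {g : A → Y} {φ : REL A A 0ℓ} →
           L φ id id → φ ⇒ pullback r f g → L r f g
  L-push {f = f} {g} {φ} Lφ φ⇒ =
    mono (pullback-residual φ⇒)
      (comp _ (graph g) (id , comp (graph f °) φ (id , L-graph° f , Lφ) , L-graph g))

module NormalLaxExtension {A : Set} {L : Ext A} (N : IsNormalLaxExtension A L) where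
  open IsNormalLaxExtension N
  open IsLaxExtension lax
  open LaxExtension lax

  toSubmonoid-normal : {φ : REL A A 0ℓ} → toSubmonoid A L φ → NormalRel A φ
  toSubmonoid-normal Lφ a C f g φ⇒ = f a , refl , sym fa≡ga
    where
    fa≡ga : f a ≡ g a
    fa≡ga = proj₁ (normal C)
              (L-push Lφ (λ φaa' → proj₂ (pullback-Id {f = f} {g}) (φ⇒ φaa'))) a

  toSubmonoid-isUpNormalSubmonoid : IsUpNormalSubmonoid A (toSubmonoid A L)
  toSubmonoid-isUpNormalSubmonoid = record
    { unit    = proj₂ (normal A) (λ _ → refl)
    ; closed  = λ {φ} {ψ} Lφ Lψ → comp φ ψ (id , Lφ , Lψ)
    ; upward  = λ Lφ φ⇒ψ → mono φ⇒ψ Lφ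
    ; normals = toSubmonoid-normal
    }

  toExtension∘toSubmonoid : {X Y : Set} (r : REL X Y 0ℓ) →
                            toExtension A (toSubmonoid A L) r ≐ L r
  toExtension∘toSubmonoid r = (λ (φ , Lφ , φ⇒) → L-push Lφ φ⇒)
                            , (λ Lrfg → _ , L-pull Lrfg , id)

module UpNormalSubmonoid {A : Set} {𝒜 : RelSet A} (S : IsUpNormalSubmonoid A 𝒜) where
  open IsUpNormalSubmonoid S

  toExtension-unit : {X Y : Set} {r : REL X Y 0ℓ} {f : A → X} {g : A → Y} →
                     (∀ a → r (f a) (g a)) → toExtension A 𝒜 r f g
  toExtension-unit r[f][g] = Id A , unit , Id⇒pullback r[f][g]

  toExtension-isLaxExtension : IsLaxExtension A (toExtension A 𝒜)
  toExtension-isLaxExtension = record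
    { mono  = λ r⇒s {f} {g} (φ , φ∈ , φ⇒) →
                φ , φ∈ , λ φaa' → pullback-mono {f = f} {g} r⇒s (φ⇒ φaa')
    ; fun   = λ f f∘h≗k → toExtension-unit f∘h≗k
    ; cofun = λ f f∘k≗h → toExtension-unit f∘k≗h
    ; comp  = λ r s {f} {h} (g , (φ , φ∈ , φ⇒) , (ψ , ψ∈ , ψ⇒)) →
                ψ · φ , closed φ∈ ψ∈ , pullback-· {f = f} {g} {h} φ⇒ ψ⇒
    }

  toExtension-normal : (X : Set) → toExtension A 𝒜 (Id X) ≐ IdE A X
  toExtension-normal X = to , toExtension-unit
    where
    to : {h k : A → X} → toExtension A 𝒜 (Id X) h k → h ≗ k
    to {h} {k} (φ , φ∈ , φ⇒) a
      with normals φ∈ a X h k (λ φaa' → proj₁ (pullback-Id {f = h} {k}) (φ⇒ φaa'))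
    ... | _ , ha≡y , ka≡y = trans ha≡y (sym ka≡y)

  toSubmonoid∘toExtension : _≡ₛ_ A (toSubmonoid A (toExtension A 𝒜)) 𝒜
  toSubmonoid∘toExtension φ =
      (λ (ψ , ψ∈ , ψ⇒) → upward ψ∈ (λ ψaa' → proj₁ (pullback-id {φ = φ}) (ψ⇒ ψaa')))
    , (λ φ∈ → φ , φ∈ , proj₂ pullback-id)

corollary35 : (A : Set) →
    ((L : Ext A) → IsNormalLaxExtension A L →
        IsUpNormalSubmonoid A (toSubmonoid A L)
      × ({X Y : Set} (r : REL X Y 0ℓ) → toExtension A (toSubmonoid A L) r ≐ L r))
    × ((𝒜 : RelSet A) → IsUpNormalSubmonoid A 𝒜 →
        IsNormalLaxExtension A (toExtension A 𝒜)
      × _≡ₛ_ A (toSubmonoid A (toExtension A 𝒜)) 𝒜)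
corollary35 A = (λ L N → let open NormalLaxExtension N in
                  toSubmonoid-isUpNormalSubmonoid , toExtension∘toSubmonoid)
              , (λ 𝒜 S → let open UpNormalSubmonoid S in
                  record { lax = toExtension-isLaxExtension ; normal = toExtension-normal }
                  , toSubmonoid∘toExtension)
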